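{- Let $q$ be an odd prime power with $q \equiv 3 \pmod 4$. For any integer $n \geq 4$ and any $a_1, \ldots, a_n \in F_q^{\ast}$, there exist points $A_1, \ldots, A_n \in F_q^2$ (a polygon $A_1 \ldots A_n$) such that $Q(A_i, A_{i+1}) = a_i$ for all $i \in \{1, \ldots, n\}$, where $A_{n+1} = A_1$.
   Context: $F_q$ denotes the finite field with $q$ elements and $F_q^{\ast}$ its nonzero elements. The quadrance between points $A_1 = [x_1, y_1]$ and $A_2 = [x_2, y_2]$ of $F_q^2$ is $Q(A_1, A_2) = (x_2 - x_1)^2 + (y_2 - y_1)^2 \in F_q$. -}

module Defs where

open import Data.Nat using (ℕ; zero; suc)
open import Data.Nat.DivMod using (_%_; m%n<n)
open import Data.Fin using (Fin; toℕ; fromℕ<)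
open import Data.Product using (_×_; _,_; ∃)
open import Relation.Binary.PropositionalEquality using (_≡_; _≢_)
open import Algebra.Structures using (IsCommutativeRing)
open import Function.Bundles using (_↔_)

record FiniteField (q : ℕ) : Set₁ where
  infixl 6 _+_ _-_
  infixl 7 _*_
  field
    Carrier : Set
    _+_ _*_ : Carrier → Carrier → Carrier
    -_      : Carrier → Carrier
    0# 1#   : Carrier
    isCommutativeRing : IsCommutativeRing _≡_ _+_ _*_ -_ 0# 1#
    0≢1     : 0# ≢ 1#
    inverse : ∀ x → x ≢ 0# → ∃ λ y → x * y ≡ 1#
    enumeration : Carrier ↔ Fin q

  _-_ : Carrier → Carrier → Carrier
  x - y = x + (- y)

  Point : Set
  Point = Carrier × Carrier

  Q : Point → Point → Carrier
  Q (x₁ , y₁) (x₂ , y₂) = (x₂ - x₁) * (x₂ - x₁) + (y₂ - y₁) * (y₂ - y₁)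

next : ∀ {n} → Fin n → Fin n
next {suc m} i = fromℕ< (m%n<n (suc (toℕ i)) (suc m))

{-# OPTIONS --safe #-}
-- Build the polygon from edge vectors v₀, …, vₙ₋₁ with norm vᵢ = aᵢ (where norm (x , y) = x² + y²)
-- summing to zero; the vertices are then the partial sums.  Since q ≡ 3 (mod 4), -1 is not a
-- square (Fermat gives i^q = i, whereas i² = -1 would give i^q = -i), so the norm is anisotropic.
-- Hence an edge w splits into two edges of quadrances a and b as soon as Wildberger's Archimedes
-- function A(a, b, norm w) is a square: the new vertex is ζ·w for some ζ in F[√-1].  Splitting
-- reduces n to 4, and a quadrilateral is two such triangles on a common diagonal c; the two
-- square conditions say that c is a common abscissa of two shifted circles.  That common abscissa,
-- like the surjectivity of the norm, comes from pigeonhole: two injections of the projective line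
-- (q + 1 points each) into Bool × F (2q points) must share a value.

module Submission where

open import Defs
open import Data.Nat using (ℕ; _≤_)
open import Data.Nat.DivMod using (_%_)
open import Data.Fin using (Fin)
open import Data.Product using (∃)
open import Relation.Binary.PropositionalEquality using (_≡_; _≢_)

open import Level using (0ℓ)
open import Data.Bool using (Bool; true; false; if_then_else_)
open import Data.Nat as ℕ using (zero; suc; s≤s; z≤n)
import Data.Nat.Properties as ℕ
open import Data.Nat.DivMod using (m≡m%n+[m/n]*n; m<n⇒m%n≡m; n%n≡0)
open import Data.Nat.Tactic.RingSolver using (solve-∀)
open import Data.Integer as ℤ using (ℤ; -[1+_]; +[1+_]; _⊖_) renaming (+_ to pos)
import Data.Integer.Properties as ℤ
import Data.Sign as Sign
import Data.Fin as Fin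
open import Data.Fin using (toℕ)
import Data.Fin.Properties as FinP
open import Data.Fin.Properties using (pigeonhole; +↔⊎; *↔×; 2↔Bool)
open import Data.Fin.Patterns using (0F; 1F; 2F; 3F)
import Data.Vec.Functional as Vec
open import Data.Vec.Functional using (_∷_; [])
open import Data.Maybe using (Maybe; just; nothing)
open import Data.Sum as Sum using (_⊎_; inj₁; inj₂; [_,_])
open import Data.Sum.Function.Propositional using (_⊎-↔_)
open import Data.Product as Product using (_×_; _,_; proj₁; proj₂; ∃₂; map₂)
open import Data.Product.Function.NonDependent.Propositional using (_×-↔_)
open import Function using (_∘_; id; flip)
open import Function.Bundles using (Inverse; Injection; _↔_; mk↔ₛ′)
open import Function.Definitions using (Injective)
open import Function.Properties.Inverse using (↔-sym; ↔-trans; ↔⇒↣)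
open import Relation.Nullary using (Dec; yes; no; does; contradiction; map′)
open import Relation.Nullary.Decidable using (dec-true; dec-false)
open import Relation.Binary.Definitions using (DecidableEquality; tri<; tri≈; tri>)
open import Relation.Binary.PropositionalEquality using (refl; sym; trans; cong; cong₂; subst; module ≡-Reasoning)
open import Algebra.Bundles using (CommutativeRing; CommutativeMonoid)
open import Algebra.Solver.Ring.AlmostCommutativeRing using (fromCommutativeRing; _-Raw-AlmostCommutative⟶_)

images-meet : ∀ {m n k} {A B C : Set} → A ↔ Fin m → B ↔ Fin n → C ↔ Fin k → k ℕ.< m ℕ.+ n →
              (f : A → C) (g : B → C) → Injective _≡_ _≡_ f → Injective _≡_ _≡_ g →
              ∃₂ λ a b → f a ≡ g b
images-meet {m} {n} {A = A} {B} {C} A↔ B↔ C↔ k<m+n f g f-injective g-injective =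
  let i , j , i<j , hᵢ≡hⱼ = pigeonhole k<m+n (Inverse.to C↔ ∘ h ∘ Inverse.from A⊎B↔)
  in  meet (Inverse.from A⊎B↔ i) (Inverse.from A⊎B↔ j)
           (FinP.<⇒≢ i<j ∘ Injection.injective (↔⇒↣ (↔-sym A⊎B↔)))
           (Injection.injective (↔⇒↣ C↔) hᵢ≡hⱼ)
  where
  A⊎B↔ : (A ⊎ B) ↔ Fin (m ℕ.+ n)
  A⊎B↔ = ↔-trans (A↔ ⊎-↔ B↔) (↔-sym +↔⊎)

  h : A ⊎ B → C
  h = [ f , g ]

  meet : ∀ x y → x ≢ y → h x ≡ h y → ∃₂ λ a b → f a ≡ g b
  meet (inj₁ a) (inj₁ a′) x≢y e = contradiction (cong inj₁ (f-injective e)) x≢y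
  meet (inj₁ a) (inj₂ b)  _   e = a , b , e
  meet (inj₂ b) (inj₁ a)  _   e = a , b , sym e
  meet (inj₂ b) (inj₂ b′) x≢y e = contradiction (cong inj₂ (g-injective e)) x≢y

module Field {q : ℕ} (F : FiniteField q) where
  open FiniteField F
  open ≡-Reasoning

  commutativeRing : CommutativeRing 0ℓ 0ℓ
  commutativeRing = record { isCommutativeRing = isCommutativeRing }

  open CommutativeRing commutativeRing
    using (+-assoc; +-comm; +-identityˡ; +-identityʳ; *-identityˡ; *-identityʳ; zeroˡ; zeroʳ;
           ring; semiring; +-abelianGroup; +-commutativeMonoid; *-commutativeMonoid; +-monoid)
  open import Algebra.Properties.Ring ring using (-‿distribˡ-*; -‿distribʳ-*; -1*x≈-x)
  open import Algebra.Properties.AbelianGroup +-abelianGroup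
    using (ε⁻¹≈ε; ⁻¹-involutive; ⁻¹-injective; ⁻¹-∙-comm; ∙-cancelˡ;
           x∙y⁻¹≈ε⇒x≈y; x≈y⇒x∙y⁻¹≈ε; inverseʳ-unique; identityʳ-unique)
  open import Algebra.Properties.Semiring.Exp semiring using (_^_)
  open import Algebra.Properties.Semiring.Mult.TCOptimised semiring
    using () renaming (_×_ to _×′_; ×-homo-+ to ×′-homo-+; ×1-homo-* to ×′1-homo-*)

  -- The type-checking-optimised multiplication makes ⟦ pos 2 ⟧ℤ reduce to 1# + 1#, so that the
  -- solver's constants match the literals in goals.
  ⟦_⟧ℤ : ℤ → Carrier
  ⟦ pos n ⟧ℤ      = n ×′ 1#
  ⟦ -[1+ n ] ⟧ℤ = - (suc n ×′ 1#)

  ⟦-⟧ : ∀ i → ⟦ ℤ.- i ⟧ℤ ≡ - ⟦ i ⟧ℤ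
  ⟦-⟧ (pos zero)   = sym ε⁻¹≈ε
  ⟦-⟧ +[1+ n ]   = refl
  ⟦-⟧ -[1+ n ]   = sym (⁻¹-involutive _)

  ⟦⊖⟧ : ∀ m n → ⟦ m ⊖ n ⟧ℤ ≡ ⟦ pos m ⟧ℤ - ⟦ pos n ⟧ℤ
  ⟦⊖⟧ m zero = begin
    ⟦ m ⊖ 0 ⟧ℤ            ≡⟨ cong ⟦_⟧ℤ (ℤ.⊖-≥ {m} z≤n) ⟩
    m ×′ 1#               ≡⟨ sym (+-identityʳ _) ⟩
    m ×′ 1# + 0#          ≡⟨ cong ((m ×′ 1#) +_) (sym ε⁻¹≈ε) ⟩
    m ×′ 1# - 0#          ∎
  ⟦⊖⟧ zero (suc n) = begin
    ⟦ 0 ⊖ suc n ⟧ℤ        ≡⟨ cong ⟦_⟧ℤ (ℤ.⊖-< {0} {suc n} (s≤s z≤n)) ⟩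
    - (suc n ×′ 1#)       ≡⟨ sym (+-identityˡ _) ⟩
    0# - suc n ×′ 1#      ∎
  ⟦⊖⟧ (suc m) (suc n) = begin
    ⟦ suc m ⊖ suc n ⟧ℤ                        ≡⟨ cong ⟦_⟧ℤ (ℤ.[1+m]⊖[1+n]≡m⊖n m n) ⟩
    ⟦ m ⊖ n ⟧ℤ                                ≡⟨ ⟦⊖⟧ m n ⟩
    m ×′ 1# - n ×′ 1#                         ≡⟨ cancel-1# (m ×′ 1#) (n ×′ 1#) ⟨
    (1# + m ×′ 1#) - (1# + n ×′ 1#)           ≡⟨ cong₂ _-_ (×′-homo-+ 1# 1 m) (×′-homo-+ 1# 1 n) ⟨
    suc m ×′ 1# - suc n ×′ 1#                 ∎
    where
    cancel-1# : ∀ x y → (1# + x) - (1# + y) ≡ x - y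
    cancel-1# x y = begin
      (1# + x) + - (1# + y)       ≡⟨ cong ((1# + x) +_) (⁻¹-∙-comm 1# y) ⟨
      (1# + x) + (- 1# + - y)     ≡⟨ cong (_+ (- 1# + - y)) (+-comm 1# x) ⟩
      (x + 1#) + (- 1# + - y)     ≡⟨ +-assoc x 1# _ ⟩
      x + (1# + (- 1# + - y))     ≡⟨ cong (x +_) (+-assoc 1# (- 1#) _) ⟨
      x + ((1# + - 1#) + - y)     ≡⟨ cong (λ z → x + (z + - y)) (CommutativeRing.-‿inverseʳ commutativeRing 1#) ⟩
      x + (0# + - y)              ≡⟨ cong (x +_) (+-identityˡ _) ⟩
      x - y                       ∎

  ⟦+⟧ : ∀ i j → ⟦ i ℤ.+ j ⟧ℤ ≡ ⟦ i ⟧ℤ + ⟦ j ⟧ℤ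
  ⟦+⟧ (pos m)  (pos n)  = ×′-homo-+ 1# m n
  ⟦+⟧ (pos m)  -[1+ n ]   = ⟦⊖⟧ m (suc n)
  ⟦+⟧ -[1+ m ]   (pos n)  = trans (⟦⊖⟧ n (suc m)) (+-comm _ _)
  ⟦+⟧ -[1+ m ]   -[1+ n ]   = begin
    - (suc (suc (m ℕ.+ n)) ×′ 1#)        ≡⟨ cong (λ k → - (suc k ×′ 1#)) (ℕ.+-suc m n) ⟨
    - ((suc m ℕ.+ suc n) ×′ 1#)          ≡⟨ cong -_ (×′-homo-+ 1# (suc m) (suc n)) ⟩
    - (suc m ×′ 1# + suc n ×′ 1#)        ≡⟨ ⁻¹-∙-comm _ _ ⟨
    - (suc m ×′ 1#) + - (suc n ×′ 1#)    ∎

  ⟦+◃⟧ : ∀ n → ⟦ Sign.+ ℤ.◃ n ⟧ℤ ≡ n ×′ 1#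
  ⟦+◃⟧ n = cong ⟦_⟧ℤ (ℤ.+◃n≡+n n)

  ⟦-◃⟧ : ∀ n → ⟦ Sign.- ℤ.◃ n ⟧ℤ ≡ - (n ×′ 1#)
  ⟦-◃⟧ n = trans (cong ⟦_⟧ℤ (ℤ.-◃n≡-n n)) (⟦-⟧ (pos n))

  ⟦*⟧ : ∀ i j → ⟦ i ℤ.* j ⟧ℤ ≡ ⟦ i ⟧ℤ * ⟦ j ⟧ℤ
  ⟦*⟧ (pos m)  (pos n)  = trans (⟦+◃⟧ (m ℕ.* n)) (×′1-homo-* m n)
  ⟦*⟧ (pos m)  -[1+ n ]   = begin
    ⟦ Sign.- ℤ.◃ (m ℕ.* suc n) ⟧ℤ        ≡⟨ ⟦-◃⟧ (m ℕ.* suc n) ⟩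
    - ((m ℕ.* suc n) ×′ 1#)              ≡⟨ cong -_ (×′1-homo-* m (suc n)) ⟩
    - (m ×′ 1# * suc n ×′ 1#)            ≡⟨ -‿distribʳ-* _ _ ⟩
    m ×′ 1# * - (suc n ×′ 1#)            ∎
  ⟦*⟧ -[1+ m ]   (pos n)  = begin
    ⟦ Sign.- ℤ.◃ (suc m ℕ.* n) ⟧ℤ        ≡⟨ ⟦-◃⟧ (suc m ℕ.* n) ⟩
    - ((suc m ℕ.* n) ×′ 1#)              ≡⟨ cong -_ (×′1-homo-* (suc m) n) ⟩
    - (suc m ×′ 1# * n ×′ 1#)            ≡⟨ -‿distribˡ-* _ _ ⟩
    - (suc m ×′ 1#) * n ×′ 1#            ∎
  ⟦*⟧ -[1+ m ]   -[1+ n ]   = begin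
    ⟦ Sign.+ ℤ.◃ (suc m ℕ.* suc n) ⟧ℤ    ≡⟨ ⟦+◃⟧ (suc m ℕ.* suc n) ⟩
    (suc m ℕ.* suc n) ×′ 1#              ≡⟨ ×′1-homo-* (suc m) (suc n) ⟩
    x * y                                ≡⟨ ⁻¹-involutive _ ⟨
    - - (x * y)                          ≡⟨ cong -_ (-‿distribˡ-* x y) ⟩
    - (- x * y)                          ≡⟨ -‿distribʳ-* _ _ ⟩
    - x * - y                            ∎
    where
    x = suc m ×′ 1#
    y = suc n ×′ 1#

  ℤ-coefficients : ℤ.+-*-rawRing -Raw-AlmostCommutative⟶ fromCommutativeRing commutativeRing
  ℤ-coefficients = record
    { ⟦_⟧ = ⟦_⟧ℤ ; +-homo = ⟦+⟧ ; *-homo = ⟦*⟧ ; -‿homo = ⟦-⟧ ; 0-homo = refl ; 1-homo = refl }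

  ⟦≟⟧ : ∀ i j → Maybe (⟦ i ⟧ℤ ≡ ⟦ j ⟧ℤ)
  ⟦≟⟧ i j with i ℤ.≟ j
  ... | yes i≡j = just (cong ⟦_⟧ℤ i≡j)
  ... | no _    = nothing

  open import Algebra.Solver.Ring ℤ.+-*-rawRing (fromCommutativeRing commutativeRing) ℤ-coefficients ⟦≟⟧
    using (solve; _:=_; _:+_; _:*_; _:-_; :-_; con; Polynomial)

  two : Carrier
  two = 1# + 1#

  :0 :1 :2 : ∀ {n} → Polynomial n
  :0 = con (pos 0)
  :1 = con (pos 1)
  :2 = con (pos 2)

  :norm : ∀ {n} → Polynomial n → Polynomial n → Polynomial n
  :norm x y = x :* x :+ y :* y

  :archimedes : ∀ {n} → Polynomial n → Polynomial n → Polynomial n → Polynomial n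
  :archimedes a b c = :2 :* (a :* b :+ b :* c :+ c :* a) :- (a :* a :+ b :* b :+ c :* c)

  enc : Carrier → Fin q
  enc = Inverse.to enumeration

  dec : Fin q → Carrier
  dec = Inverse.from enumeration

  dec-enc : ∀ x → dec (enc x) ≡ x
  dec-enc = Inverse.strictlyInverseʳ enumeration

  enc-injective : Injective _≡_ _≡_ enc
  enc-injective = Injection.injective (↔⇒↣ enumeration)

  infix 4 _≟_
  _≟_ : DecidableEquality Carrier
  x ≟ y = map′ enc-injective (cong enc) (enc x Fin.≟ enc y)

  1#≢0# : 1# ≢ 0#
  1#≢0# = 0≢1 ∘ sym

  x-y≡0⇒x≡y : ∀ {x y} → x - y ≡ 0# → x ≡ y
  x-y≡0⇒x≡y = x∙y⁻¹≈ε⇒x≈y _ _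

  x+y≡0⇒y≡-x : ∀ {x y} → x + y ≡ 0# → y ≡ - x
  x+y≡0⇒y≡-x = inverseʳ-unique _ _

  x*y≡0⇒x≡0⊎y≡0 : ∀ {x y} → x * y ≡ 0# → x ≡ 0# ⊎ y ≡ 0#
  x*y≡0⇒x≡0⊎y≡0 {x} {y} xy≡0 with x ≟ 0#
  ... | yes x≡0 = inj₁ x≡0
  ... | no  x≢0 = let x⁻¹ , xx⁻¹≡1 = inverse x x≢0 in inj₂ (begin
    y               ≡⟨ *-identityˡ y ⟨
    1# * y          ≡⟨ cong (_* y) xx⁻¹≡1 ⟨
    (x * x⁻¹) * y   ≡⟨ solve 3 (λ x x⁻¹ y → (x :* x⁻¹) :* y := x⁻¹ :* (x :* y)) refl x x⁻¹ y ⟩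
    x⁻¹ * (x * y)   ≡⟨ cong (x⁻¹ *_) xy≡0 ⟩
    x⁻¹ * 0#        ≡⟨ zeroʳ x⁻¹ ⟩
    0#              ∎)

  *-≢0 : ∀ {x y} → x ≢ 0# → y ≢ 0# → x * y ≢ 0#
  *-≢0 x≢0 y≢0 = [ x≢0 , y≢0 ] ∘ x*y≡0⇒x≡0⊎y≡0

  *-cancelˡ : ∀ {x y z} → x ≢ 0# → x * y ≡ x * z → y ≡ z
  *-cancelˡ {x} {y} {z} x≢0 xy≡xz = x-y≡0⇒x≡y ([ flip contradiction x≢0 , id ] (x*y≡0⇒x≡0⊎y≡0 (begin
    x * (y - z)     ≡⟨ solve 3 (λ x y z → x :* (y :- z) := x :* y :- x :* z) refl x y z ⟩
    x * y - x * z   ≡⟨ x≈y⇒x∙y⁻¹≈ε xy≡xz ⟩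
    0#              ∎)))

  x*x≡y*y⇒y≡±x : ∀ {x y} → x * x ≡ y * y → y ≡ x ⊎ y ≡ - x
  x*x≡y*y⇒y≡±x {x} {y} x²≡y² = Sum.map x-y≡0⇒x≡y (x+y≡0⇒y≡-x ∘ trans (+-comm x y))
    (x*y≡0⇒x≡0⊎y≡0 (begin
      (y - x) * (y + x)   ≡⟨ solve 2 (λ x y → (y :- x) :* (y :+ x) := y :* y :- x :* x) refl x y ⟩
      y * y - x * x       ≡⟨ x≈y⇒x∙y⁻¹≈ε (sym x²≡y²) ⟩
      0#                  ∎))

  module FieldSum (M : CommutativeMonoid 0ℓ 0ℓ) where
    open CommutativeMonoid M
      using (_≈_; _∙_; ε; ∙-congˡ; identityʳ; monoid)
      renaming (Carrier to A; trans to ≈-trans; reflexive to ≈-reflexive)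
    open import Algebra.Properties.CommutativeMonoid.Sum M
      using (sum; sum-permute; sum-remove; sum-cong-≗; sum-cong-≋; sum-replicate; sum-replicate-zero; ∑-distrib-+)
    open import Algebra.Properties.Monoid.Mult monoid using () renaming (_×_ to _·_)

    ∑ : (Carrier → A) → A
    ∑ f = sum (f ∘ dec)

    ∑-reindex : (σ : Carrier ↔ Carrier) (f : Carrier → A) → ∑ f ≈ ∑ (f ∘ Inverse.to σ)
    ∑-reindex σ f = ≈-trans (sum-permute (f ∘ dec) π)
                            (≈-reflexive (sum-cong-≗ (cong f ∘ dec-enc ∘ Inverse.to σ ∘ dec)))
      where
      π : Fin q ↔ Fin q
      π = ↔-trans (↔-sym enumeration) (↔-trans σ enumeration)

    ∑-cong : ∀ {f g : Carrier → A} → (∀ x → f x ≡ g x) → ∑ f ≡ ∑ g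
    ∑-cong f≗g = sum-cong-≗ (f≗g ∘ dec)

    ∑-distrib : (f g : Carrier → A) → ∑ (λ x → f x ∙ g x) ≈ ∑ f ∙ ∑ g
    ∑-distrib f g = ∑-distrib-+ (f ∘ dec) (g ∘ dec)

    ∑-const : ∀ a → ∑ (λ _ → a) ≈ q · a
    ∑-const a = sum-replicate q

    ∑-supported-at : ∀ a (f : Carrier → A) → (∀ y → y ≢ a → f y ≈ ε) → ∑ f ≈ f a
    ∑-supported-at a f f≈ε = ≈-trans (sum-supported-at (f ∘ dec) (enc a) t≈ε) (≈-reflexive (cong f (dec-enc a)))
      where
      t≈ε : ∀ j → j ≢ enc a → f (dec j) ≈ ε
      t≈ε j j≢a = f≈ε (dec j) (j≢a ∘ trans (sym (Inverse.strictlyInverseˡ enumeration j)) ∘ cong enc)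

      sum-supported-at : ∀ {n} (t : Fin n → A) i → (∀ j → j ≢ i → t j ≈ ε) → sum t ≈ t i
      sum-supported-at {suc n} t i t≈ε = ≈-trans (sum-remove {i = i} t) (≈-trans
        (∙-congˡ (≈-trans (sum-cong-≋ (λ j → t≈ε _ (FinP.punchInᵢ≢i i j))) (sum-replicate-zero n)))
        (identityʳ (t i)))

  open FieldSum +-commutativeMonoid using (∑; ∑-reindex; ∑-distrib; ∑-const)
  open FieldSum *-commutativeMonoid using ()
    renaming (∑ to ∏; ∑-cong to ∏-cong; ∑-reindex to ∏-reindex; ∑-distrib to ∏-distrib;
              ∑-const to ∏-const; ∑-supported-at to ∏-supported-at)

  translation : Carrier → Carrier ↔ Carrier
  translation a = mk↔ₛ′ (_+ a) (_- a)
    (solve 2 (λ a y → (y :- a) :+ a := y) refl a)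
    (solve 2 (λ a x → (x :+ a) :- a := x) refl a)

  open import Algebra.Properties.Monoid.Mult +-monoid using () renaming (_×_ to _·_)

  q·1#≡0# : q · 1# ≡ 0#
  q·1#≡0# = identityʳ-unique S (q · 1#) (sym (begin
    S                  ≡⟨ ∑-reindex (translation 1#) id ⟩
    ∑ (_+ 1#)          ≡⟨ ∑-distrib id (λ _ → 1#) ⟩
    S + ∑ (λ _ → 1#)   ≡⟨ cong (S +_) (∑-const 1#) ⟩
    S + q · 1#         ∎))
    where
    S = ∑ id

  scaling : ∀ {a} → a ≢ 0# → Carrier ↔ Carrier
  scaling {a} a≢0 = mk↔ₛ′ (a *_) (a⁻¹ *_)
    (λ y → trans (solve 3 (λ a a⁻¹ y → a :* (a⁻¹ :* y) := (a :* a⁻¹) :* y) refl a a⁻¹ y) (cancel y))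
    (λ x → trans (solve 3 (λ a a⁻¹ x → a⁻¹ :* (a :* x) := (a :* a⁻¹) :* x) refl a a⁻¹ x) (cancel x))
    where
    a⁻¹ = proj₁ (inverse a a≢0)
    cancel : ∀ x → (a * a⁻¹) * x ≡ x
    cancel x = trans (cong (_* x) (proj₂ (inverse a a≢0))) (*-identityˡ x)

  if0 : Carrier → Carrier → Carrier → Carrier
  if0 y a b = if does (y ≟ 0#) then a else b

  if0-≡0 : ∀ {y} a b → y ≡ 0# → if0 y a b ≡ a
  if0-≡0 {y} a b y≡0 = cong (if_then a else b) (dec-true (y ≟ 0#) y≡0)

  if0-≢0 : ∀ {y} a b → y ≢ 0# → if0 y a b ≡ b
  if0-≢0 {y} a b y≢0 = cong (if_then a else b) (dec-false (y ≟ 0#) y≢0)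

  ∏-≢0 : ∀ f → (∀ y → f y ≢ 0#) → ∏ f ≢ 0#
  ∏-≢0 f f≢0 = product-≢0 (f ∘ dec) (f≢0 ∘ dec)
    where
    product-≢0 : ∀ {n} (t : Fin n → Carrier) → (∀ i → t i ≢ 0#) → Vec.foldr _*_ 1# t ≢ 0#
    product-≢0 {zero}  _ _   = 1#≢0#
    product-≢0 {suc n} t t≢0 = *-≢0 (t≢0 Fin.zero) (product-≢0 (Vec.tail t) (t≢0 ∘ Fin.suc))

  fermat : ∀ {x} → x ≢ 0# → x ^ q ≡ x
  fermat {x} x≢0 = *-cancelˡ (∏-≢0 unit unit≢0) (begin
    ∏ unit * x ^ q                  ≡⟨ cong (∏ unit *_) (∏-const x) ⟨
    ∏ unit * ∏ (λ _ → x)            ≡⟨ ∏-distrib unit (λ _ → x) ⟨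
    ∏ (λ y → unit y * x)            ≡⟨ ∏-cong rescale ⟩
    ∏ (λ y → unit (x * y) * δ y)    ≡⟨ ∏-distrib (unit ∘ (x *_)) δ ⟩
    ∏ (unit ∘ (x *_)) * ∏ δ         ≡⟨ cong₂ _*_ (sym (∏-reindex (scaling x≢0) unit)) ∏δ≡x ⟩
    ∏ unit * x                      ∎)
    where
    unit δ : Carrier → Carrier
    unit y = if0 y 1# y
    δ y = if0 y x 1#
    unit≢0 : ∀ y → unit y ≢ 0#
    unit≢0 y = by-cases (y ≟ 0#)
      where
      by-cases : Dec (y ≡ 0#) → unit y ≢ 0#
      by-cases (yes y≡0) = 1#≢0# ∘ trans (sym (if0-≡0 1# y y≡0))
      by-cases (no  y≢0) = y≢0 ∘ trans (sym (if0-≢0 1# y y≢0))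

    rescale : ∀ y → unit y * x ≡ unit (x * y) * δ y
    rescale y = by-cases (y ≟ 0#)
      where
      by-cases : Dec (y ≡ 0#) → unit y * x ≡ unit (x * y) * δ y
      by-cases (yes y≡0) = begin
        unit y * x              ≡⟨ cong (_* x) (if0-≡0 1# y y≡0) ⟩
        1# * x                  ≡⟨ cong₂ _*_ (if0-≡0 1# (x * y) (trans (cong (x *_) y≡0) (zeroʳ x))) (if0-≡0 x 1# y≡0) ⟨
        unit (x * y) * δ y      ∎
      by-cases (no y≢0) = begin
        unit y * x              ≡⟨ cong (_* x) (if0-≢0 1# y y≢0) ⟩
        y * x                   ≡⟨ solve 2 (λ x y → y :* x := (x :* y) :* :1) refl x y ⟩
        (x * y) * 1#            ≡⟨ cong₂ _*_ (if0-≢0 1# (x * y) (*-≢0 x≢0 y≢0)) (if0-≢0 x 1# y≢0) ⟨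
        unit (x * y) * δ y      ∎
    ∏δ≡x : ∏ δ ≡ x
    ∏δ≡x = trans (∏-supported-at 0# δ (λ _ → if0-≢0 x 1#)) (if0-≡0 x 1# refl)

  ·-odd : ∀ {x} → x + x ≡ 0# → ∀ n → (1 ℕ.+ n ℕ.* 2) · x ≡ x
  ·-odd {x} _     zero    = +-identityʳ x
  ·-odd {x} x+x≡0 (suc n) = begin
    x + (x + (1 ℕ.+ n ℕ.* 2) · x)   ≡⟨ +-assoc x x _ ⟨
    (x + x) + (1 ℕ.+ n ℕ.* 2) · x   ≡⟨ cong (_+ (1 ℕ.+ n ℕ.* 2) · x) x+x≡0 ⟩
    0# + (1 ℕ.+ n ℕ.* 2) · x        ≡⟨ +-identityˡ _ ⟩
    (1 ℕ.+ n ℕ.* 2) · x             ≡⟨ ·-odd x+x≡0 n ⟩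
    x                               ∎

  ^-period-4 : ∀ {i} → i * i ≡ - 1# → ∀ k → i ^ (k ℕ.* 4) ≡ 1#
  ^-period-4 {i} _      zero    = refl
  ^-period-4 {i} i²≡-1 (suc k) = begin
    i * (i * (i * (i * i ^ (k ℕ.* 4))))   ≡⟨ solve 2 (λ i z →
      i :* (i :* (i :* (i :* z))) := (i :* i) :* (i :* i) :* z) refl i _ ⟩
    (i * i) * (i * i) * i ^ (k ℕ.* 4)     ≡⟨ cong₂ (λ u v → u * u * v) i²≡-1 (^-period-4 i²≡-1 k) ⟩
    - 1# * - 1# * 1#                      ≡⟨ solve 0 (:- :1 :* :- :1 :* :1 := :1) refl ⟩
    1#                                    ∎

  q%4≡3⇒-1-nonsquare : q % 4 ≡ 3 → ∀ i → i * i ≢ - 1#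
  q%4≡3⇒-1-nonsquare q%4≡3 i i²≡-1 = 1#≢0# (begin
    1#                                  ≡⟨ ·-odd 2≡0 (1 ℕ.+ k ℕ.* 2) ⟨
    (1 ℕ.+ (1 ℕ.+ k ℕ.* 2) ℕ.* 2) · 1#   ≡⟨ cong (_· 1#) (trans q≡3+4k (3+4k≡1+[1+2k]2 k)) ⟨
    q · 1#                              ≡⟨ q·1#≡0# ⟩
    0#                                  ∎)
    where
    k = q ℕ./ 4
    q≡3+4k : q ≡ 3 ℕ.+ k ℕ.* 4
    q≡3+4k = trans (m≡m%n+[m/n]*n q 4) (cong (ℕ._+ k ℕ.* 4) q%4≡3)

    3+4k≡1+[1+2k]2 : ∀ k → 3 ℕ.+ k ℕ.* 4 ≡ 1 ℕ.+ (1 ℕ.+ k ℕ.* 2) ℕ.* 2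
    3+4k≡1+[1+2k]2 = solve-∀

    i≢0 : i ≢ 0#
    i≢0 i≡0 = 1#≢0# (begin
      1#        ≡⟨ ⁻¹-involutive 1# ⟨
      - - 1#    ≡⟨ cong -_ (trans (sym i²≡-1) (trans (cong (λ z → z * z) i≡0) (zeroʳ 0#))) ⟩
      - 0#      ≡⟨ ε⁻¹≈ε ⟩
      0#        ∎)

    i≡-i : i ≡ - i
    i≡-i = begin
      i                                    ≡⟨ fermat i≢0 ⟨
      i ^ q                                ≡⟨ cong (i ^_) q≡3+4k ⟩
      i * (i * (i * i ^ (k ℕ.* 4)))        ≡⟨ cong (λ z → i * (i * (i * z))) (^-period-4 i²≡-1 k) ⟩
      i * (i * (i * 1#))                   ≡⟨ solve 1 (λ i → i :* (i :* (i :* :1)) := (i :* i) :* i) refl i ⟩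
      (i * i) * i                          ≡⟨ cong (_* i) i²≡-1 ⟩
      - 1# * i                             ≡⟨ -1*x≈-x i ⟩
      - i                                  ∎

    2≡0 : two ≡ 0#
    2≡0 = [ id , flip contradiction i≢0 ] (x*y≡0⇒x≡0⊎y≡0 (begin
      two * i          ≡⟨ solve 1 (λ i → :2 :* i := i :+ i) refl i ⟩
      i + i            ≡⟨ cong (i +_) i≡-i ⟩
      i - i            ≡⟨ CommutativeRing.-‿inverseʳ commutativeRing i ⟩
      0#               ∎))

  sign : Carrier → Bool
  sign x = does (enc x Fin.<? enc (- x))

  sign-0# : sign 0# ≡ false
  sign-0# = trans (cong (λ z → does (enc 0# Fin.<? enc z)) ε⁻¹≈ε) (dec-false (enc 0# Fin.<? enc 0#) (FinP.<-irrefl refl))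

  sign-neg : ∀ x → sign (- x) ≡ does (enc (- x) Fin.<? enc x)
  sign-neg x = cong (λ z → does (enc (- x) Fin.<? enc z)) (⁻¹-involutive x)

  sign-≡⇒≡- : ∀ x → sign x ≡ sign (- x) → x ≡ - x
  sign-≡⇒≡- x sx≡s-x with FinP.<-cmp (enc x) (enc (- x))
  ... | tri≈ _ e _  = enc-injective e
  ... | tri< lt _ _ = contradiction (begin
    true                           ≡⟨ dec-true (enc x Fin.<? enc (- x)) lt ⟨
    sign x                         ≡⟨ trans sx≡s-x (sign-neg x) ⟩
    does (enc (- x) Fin.<? enc x)  ≡⟨ dec-false (enc (- x) Fin.<? enc x) (FinP.<-asym lt) ⟩
    false                          ∎) λ ()
  ... | tri> _ _ gt = contradiction (begin
    false                          ≡⟨ dec-false (enc x Fin.<? enc (- x)) (FinP.<-asym gt) ⟨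
    sign x                         ≡⟨ trans sx≡s-x (sign-neg x) ⟩
    does (enc (- x) Fin.<? enc x)  ≡⟨ dec-true (enc (- x) Fin.<? enc x) gt ⟩
    true                           ∎) λ ()

  ±-by-sign : ∀ {x y} → sign x ≡ sign y → y ≡ x ⊎ y ≡ - x → y ≡ x
  ±-by-sign     _     (inj₁ y≡x)  = y≡x
  ±-by-sign {x} sx≡sy (inj₂ y≡-x) = trans y≡-x (sym (sign-≡⇒≡- x (trans sx≡sy (cong sign y≡-x))))

  ℙ¹ : Set
  ℙ¹ = Maybe Carrier

  ℙ¹↔Fin : ℙ¹ ↔ Fin (suc q)
  ℙ¹↔Fin = mk↔ₛ′ to from to∘from from∘to
    where
    to : ℙ¹ → Fin (suc q)
    to nothing  = Fin.zero
    to (just x) = Fin.suc (enc x)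

    from : Fin (suc q) → ℙ¹
    from Fin.zero    = nothing
    from (Fin.suc j) = just (dec j)

    to∘from : ∀ j → to (from j) ≡ j
    to∘from Fin.zero    = refl
    to∘from (Fin.suc j) = cong Fin.suc (Inverse.strictlyInverseˡ enumeration j)

    from∘to : ∀ p → from (to p) ≡ p
    from∘to nothing  = refl
    from∘to (just x) = cong just (dec-enc x)

  ℙ¹-images-meet : (f g : ℙ¹ → Bool × Carrier) → Injective _≡_ _≡_ f → Injective _≡_ _≡_ g →
                   ∃₂ λ u v → f u ≡ g v
  ℙ¹-images-meet = images-meet ℙ¹↔Fin ℙ¹↔Fin (↔-trans (↔-sym 2↔Bool ×-↔ enumeration) (↔-sym *↔×))
    (ℕ.+-mono-< (ℕ.n<1+n q) (s≤s (ℕ.≤-reflexive (ℕ.+-identityʳ q))))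

  InjectiveUpToSign : (Carrier → Carrier) → Set
  InjectiveUpToSign φ = ∀ {x y} → φ x ≡ φ y → y ≡ x ⊎ y ≡ - x

  φ0≡φy⇒y≡0 : ∀ {φ} → InjectiveUpToSign φ → ∀ {y} → φ 0# ≡ φ y → y ≡ 0#
  φ0≡φy⇒y≡0 φ-inj φ0≡φy = [ id , flip trans ε⁻¹≈ε ] (φ-inj φ0≡φy)

  -- The sign bit separates x from -x, and ∞ is a second copy of 0 with the other sign, so an
  -- even function that is injective up to sign becomes injective on ℙ¹.
  signed : ℙ¹ → Bool × Carrier
  signed nothing  = true , 0#
  signed (just x) = sign x , x

  signed-injective : ∀ {φ} → InjectiveUpToSign φ → Injective _≡_ _≡_ (map₂ φ ∘ signed)
  signed-injective φ-inj {nothing} {nothing} _ = refl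
  signed-injective φ-inj {nothing} {just y}  e = contradiction
    (trans (cong proj₁ e) (trans (cong sign (φ0≡φy⇒y≡0 φ-inj (cong proj₂ e))) sign-0#)) λ ()
  signed-injective φ-inj {just x}  {nothing} e = contradiction
    (trans (cong proj₁ (sym e)) (trans (cong sign (φ0≡φy⇒y≡0 φ-inj (cong proj₂ (sym e)))) sign-0#)) λ ()
  signed-injective φ-inj {just x}  {just y}  e = cong just (sym (±-by-sign (cong proj₁ e) (φ-inj (cong proj₂ e))))

  infixl 6 _+ᵥ_ _-ᵥ_
  infixl 7 _*ᵥ_ _·ᵥ_
  infix  8 -ᵥ_

  0ᵥ 1ᵥ : Point
  0ᵥ = 0# , 0#
  1ᵥ = 1# , 0#

  _+ᵥ_ _-ᵥ_ _*ᵥ_ : Point → Point → Point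
  (a , b) +ᵥ (c , d) = a + c , b + d
  (a , b) -ᵥ (c , d) = a - c , b - d
  (a , b) *ᵥ (c , d) = a * c - b * d , a * d + b * c

  -ᵥ_ : Point → Point
  -ᵥ (a , b) = - a , - b

  _·ᵥ_ : Carrier → Point → Point
  t ·ᵥ (a , b) = t * a , t * b

  norm : Point → Carrier
  norm (x , y) = x * x + y * y

  norm-surjective : ∀ a → ∃ λ P → norm P ≡ a
  norm-surjective a =
    let u , v , e = ℙ¹-images-meet _ _ (signed-injective {λ x → x * x} x*x≡y*y⇒y≡±x)
                                       (signed-injective {λ y → a - y * y} (x*x≡y*y⇒y≡±x ∘ ⁻¹-injective ∘ ∙-cancelˡ a _ _))
        x = proj₂ (signed u)
        y = proj₂ (signed v)
    in (x , y) , (begin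
      x * x + y * y           ≡⟨ cong (_+ y * y) (cong proj₂ e) ⟩
      (a - y * y) + y * y     ≡⟨ solve 2 (λ a z → (a :- z) :+ z := a) refl a (y * y) ⟩
      a                       ∎)

  +ᵥ-cancelˡ : ∀ {P u v} → P +ᵥ u ≡ P +ᵥ v → u ≡ v
  +ᵥ-cancelˡ P+u≡P+v = cong₂ _,_ (∙-cancelˡ _ _ _ (cong proj₁ P+u≡P+v)) (∙-cancelˡ _ _ _ (cong proj₂ P+u≡P+v))

  on-circle-injective : ∀ {P P′} → norm P ≡ norm P′ → proj₁ P ≡ proj₁ P′ →
                        sign (proj₂ P) ≡ sign (proj₂ P′) → P ≡ P′
  on-circle-injective {x , y} {.x , y′} P²≡P′² refl sy≡sy′ =
    cong (x ,_) (sym (±-by-sign sy≡sy′ (x*x≡y*y⇒y≡±x (∙-cancelˡ (x * x) _ _ P²≡P′²))))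

  norm-*ᵥ : ∀ z w → norm (z *ᵥ w) ≡ norm z * norm w
  norm-*ᵥ (a , b) (c , d) = solve 4 (λ a b c d →
    :norm (a :* c :- b :* d) (a :* d :+ b :* c) := :norm a b :* :norm c d) refl a b c d

  norm-ᵥ : ∀ P → norm (-ᵥ P) ≡ norm P
  norm-ᵥ (x , y) = solve 2 (λ x y → :norm (:- x) (:- y) := :norm x y) refl x y

  w-ζw≡[1-ζ]w : ∀ ζ w → w -ᵥ ζ *ᵥ w ≡ (1ᵥ -ᵥ ζ) *ᵥ w
  w-ζw≡[1-ζ]w (α , β) (x , y) = cong₂ _,_
    (solve 4 (λ α β x y → x :- (α :* x :- β :* y) := (:1 :- α) :* x :- (:0 :- β) :* y) refl α β x y)
    (solve 4 (λ α β x y → y :- (α :* y :+ β :* x) := (:1 :- α) :* y :+ (:0 :- β) :* x) refl α β x y)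

  -- Wildberger's Archimedes function: 16·(area)² of a triangle with quadrances a, b, c.
  archimedes : Carrier → Carrier → Carrier → Carrier
  archimedes a b c = two * (a * b + b * c + c * a) - (a * a + b * b + c * c)

  archimedes-shift : ∀ {a b t s} → norm (t , s) ≡ two * two * (a * b) → archimedes a b (a + b + t) ≡ s * s
  archimedes-shift {a} {b} {t} {s} t²+s²≡4ab = begin
    archimedes a b (a + b + t)   ≡⟨ solve 3 (λ a b t →
      :archimedes a b (a :+ b :+ t) := :2 :* :2 :* (a :* b) :- t :* t) refl a b t ⟩
    two * two * (a * b) - t * t  ≡⟨ cong (_- t * t) t²+s²≡4ab ⟨
    (t * t + s * s) - t * t      ≡⟨ solve 2 (λ t s → :norm t s :- t :* t := s :* s) refl t s ⟩
    s * s                        ∎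

  ∑ᵥ : ∀ {n} → (Fin n → Point) → Point
  ∑ᵥ = Vec.foldr _+ᵥ_ 0ᵥ

  -- A polygon is recorded by its edge vectors, which close up iff they sum to 0ᵥ.
  Polygon : ∀ {n} → (Fin n → Carrier) → Set
  Polygon {n} a = ∃ λ (v : Fin n → Point) → (∀ i → norm (v i) ≡ a i) × ∑ᵥ v ≡ 0ᵥ

  partialSum : ∀ {n} → (Fin n → Point) → ℕ → Point
  partialSum         v zero    = 0ᵥ
  partialSum {zero}  v (suc k) = 0ᵥ
  partialSum {suc n} v (suc k) = Vec.head v +ᵥ partialSum (Vec.tail v) k

  partialSum-suc : ∀ {n} (v : Fin n → Point) i → partialSum v (suc (toℕ i)) ≡ partialSum v (toℕ i) +ᵥ v i
  partialSum-suc v Fin.zero    = cong₂ _,_ (+-comm _ 0#) (+-comm _ 0#)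
  partialSum-suc v (Fin.suc i) = trans (cong (Vec.head v +ᵥ_) (partialSum-suc (Vec.tail v) i))
    (cong₂ _,_ (sym (+-assoc _ _ _)) (sym (+-assoc _ _ _)))

  partialSum-all : ∀ {n} (v : Fin n → Point) → partialSum v n ≡ ∑ᵥ v
  partialSum-all {zero}  v = refl
  partialSum-all {suc n} v = cong (Vec.head v +ᵥ_) (partialSum-all (Vec.tail v))

  partialSum-next : ∀ {n} (v : Fin n → Point) → ∑ᵥ v ≡ 0ᵥ → (i : Fin n) →
                    partialSum v (toℕ (next i)) ≡ partialSum v (suc (toℕ i))
  partialSum-next {suc n} v closed i = trans (cong (partialSum v) (FinP.toℕ-fromℕ< _)) (wrap (toℕ i ℕ.<? n))
    where
    wrap : Dec (toℕ i ℕ.< n) → partialSum v (suc (toℕ i) % suc n) ≡ partialSum v (suc (toℕ i))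
    wrap (yes i<n) = cong (partialSum v) (m<n⇒m%n≡m (s≤s i<n))
    wrap (no  i≮n) = begin
      partialSum v (suc (toℕ i) % suc n)   ≡⟨ cong (λ k → partialSum v (suc k % suc n)) i≡n ⟩
      partialSum v (suc n % suc n)         ≡⟨ cong (partialSum v) (n%n≡0 (suc n)) ⟩
      0ᵥ                                   ≡⟨ closed ⟨
      ∑ᵥ v                                 ≡⟨ partialSum-all v ⟨
      partialSum v (suc n)                 ≡⟨ cong (partialSum v ∘ suc) i≡n ⟨
      partialSum v (suc (toℕ i))           ∎
      where
      i≡n : toℕ i ≡ n
      i≡n = ℕ.≤-antisym (FinP.toℕ≤pred[n] i) (ℕ.≮⇒≥ i≮n)

  Q-+ᵥ : ∀ P u → Q P (P +ᵥ u) ≡ norm u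
  Q-+ᵥ (x , y) (u , v) = cong₂ (λ s t → s * s + t * t)
    (solve 2 (λ x u → (x :+ u) :- x := u) refl x u) (solve 2 (λ y v → (y :+ v) :- y := v) refl y v)

  vertices : ∀ {n} {a : Fin n → Carrier} → Polygon a → ∃ λ (A : Fin n → Point) → ∀ i → Q (A i) (A (next i)) ≡ a i
  vertices {a = a} (v , v≡a , closed) = A , λ i → begin
    Q (A i) (A (next i))    ≡⟨ cong (Q (A i)) (trans (partialSum-next v closed i) (partialSum-suc v i)) ⟩
    Q (A i) (A i +ᵥ v i)    ≡⟨ Q-+ᵥ (A i) (v i) ⟩
    norm (v i)              ≡⟨ v≡a i ⟩
    a i                     ∎
    where
    A = λ i → partialSum v (toℕ i)

  direction : ℙ¹ → Point
  direction nothing  = 0# , 1#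
  direction (just m) = 1# , m

  scaled-directions : ∀ {t t′} p p′ → t ·ᵥ direction p ≡ t′ ·ᵥ direction p′ →
                      p ≡ p′ ⊎ (t ≡ 0# × t′ ≡ 0#)
  scaled-directions nothing nothing _ = inj₁ refl
  scaled-directions {t} {t′} (just m) nothing e = inj₂ (t≡0 , (begin
    t′         ≡⟨ *-identityʳ t′ ⟨
    t′ * 1#    ≡⟨ cong proj₂ e ⟨
    t * m      ≡⟨ cong (_* m) t≡0 ⟩
    0# * m     ≡⟨ zeroˡ m ⟩
    0#         ∎))
    where
    t≡0 : t ≡ 0#
    t≡0 = trans (sym (*-identityʳ t)) (trans (cong proj₁ e) (zeroʳ t′))
  scaled-directions nothing (just m) e = Sum.map sym Product.swap (scaled-directions (just m) nothing (sym e))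
  scaled-directions {t} {t′} (just m) (just m′) e = by-cases (t ≟ 0#)
    where
    t≡t′ : t ≡ t′
    t≡t′ = trans (sym (*-identityʳ t)) (trans (cong proj₁ e) (*-identityʳ t′))

    by-cases : Dec (t ≡ 0#) → just m ≡ just m′ ⊎ (t ≡ 0# × t′ ≡ 0#)
    by-cases (yes t≡0) = inj₂ (t≡0 , trans (sym t≡t′) t≡0)
    by-cases (no  t≢0) = inj₁ (cong just (*-cancelˡ t≢0 (trans (cong proj₂ e) (cong (_* m′) (sym t≡t′)))))

  dot : Point → Point → Carrier
  dot (a , b) (c , d) = a * c + b * d

  perpendicular-to-direction : ∀ {α β m} → dot (α , β) (direction (just m)) ≡ 0# → β ≡ 0# → (α , β) ≡ 0ᵥ
  perpendicular-to-direction {α} {β} {m} α+βm≡0 β≡0 = cong₂ _,_ (begin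
    α                              ≡⟨ solve 3 (λ α β m → α := (α :* :1 :+ β :* m) :- β :* m) refl α β m ⟩
    (α * 1# + β * m) - β * m       ≡⟨ cong₂ (λ d b → d - b * m) α+βm≡0 β≡0 ⟩
    0# - 0# * m                    ≡⟨ solve 1 (λ m → :0 :- :0 :* m := :0) refl m ⟩
    0#                             ∎) β≡0

  perpendicular-direction-unique : ∀ {B} → B ≢ 0ᵥ → ∀ p p′ →
                                   dot B (direction p) ≡ 0# → dot B (direction p′) ≡ 0# → p ≡ p′
  perpendicular-direction-unique B≢0 nothing  nothing   _  _  = refl
  perpendicular-direction-unique {α , β} B≢0 (just m) nothing d₁ d₂ = contradiction
    (perpendicular-to-direction d₁ (trans (solve 2 (λ α β → β := α :* :0 :+ β :* :1) refl α β) d₂)) B≢0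
  perpendicular-direction-unique B≢0 nothing (just m) d₁ d₂ =
    sym (perpendicular-direction-unique B≢0 (just m) nothing d₂ d₁)
  perpendicular-direction-unique {α , β} B≢0 (just m) (just m′) d₁ d₂ with x*y≡0⇒x≡0⊎y≡0 (begin
    β * (m - m′)                                        ≡⟨ solve 4 (λ α β m m′ →
      β :* (m :- m′) := (α :* :1 :+ β :* m) :- (α :* :1 :+ β :* m′)) refl α β m m′ ⟩
    dot (α , β) (1# , m) - dot (α , β) (1# , m′)         ≡⟨ x≈y⇒x∙y⁻¹≈ε (trans d₁ (sym d₂)) ⟩
    0#                                                  ∎)
  ... | inj₁ β≡0     = contradiction (perpendicular-to-direction d₁ β≡0) B≢0
  ... | inj₂ m-m′≡0  = cong just (x-y≡0⇒x≡y m-m′≡0)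

  module Anisotropic (-1-nonsquare : ∀ i → i * i ≢ - 1#) where

    two≢0 : two ≢ 0#
    two≢0 2≡0 = -1-nonsquare 1# (trans (*-identityˡ 1#) (x+y≡0⇒y≡-x 2≡0))

    two*x≡0⇒x≡0 : ∀ {x} → two * x ≡ 0# → x ≡ 0#
    two*x≡0⇒x≡0 = [ flip contradiction two≢0 , id ] ∘ x*y≡0⇒x≡0⊎y≡0

    norm≡0⇒x≡0 : ∀ {x y} → norm (x , y) ≡ 0# → x ≡ 0#
    norm≡0⇒x≡0 {x} {y} x²+y²≡0 with x ≟ 0#
    ... | yes x≡0 = x≡0
    ... | no  x≢0 = let x⁻¹ , xx⁻¹≡1 = inverse x x≢0 in contradiction (begin
      (y * x⁻¹) * (y * x⁻¹)                            ≡⟨ solve 3 (λ x y x⁻¹ →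
        (y :* x⁻¹) :* (y :* x⁻¹) := :norm x y :* (x⁻¹ :* x⁻¹) :- (x :* x⁻¹) :* (x :* x⁻¹)) refl x y x⁻¹ ⟩
      norm (x , y) * (x⁻¹ * x⁻¹) - (x * x⁻¹) * (x * x⁻¹) ≡⟨ cong₂ (λ n u → n * (x⁻¹ * x⁻¹) - u * u) x²+y²≡0 xx⁻¹≡1 ⟩
      0# * (x⁻¹ * x⁻¹) - 1# * 1#                         ≡⟨ solve 1 (λ z → :0 :* z :- :1 :* :1 := :- :1) refl _ ⟩
      - 1#                                               ∎) (-1-nonsquare (y * x⁻¹))

    norm≡0⇒≡0ᵥ : ∀ {P} → norm P ≡ 0# → P ≡ 0ᵥ
    norm≡0⇒≡0ᵥ P²≡0 = cong₂ _,_ (norm≡0⇒x≡0 P²≡0) (norm≡0⇒x≡0 (trans (+-comm _ _) P²≡0))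

    archimedes-at-0 : ∀ {a b s} → archimedes a b 0# ≡ s * s → a ≡ b
    archimedes-at-0 {a} {b} {s} A≡s² = x-y≡0⇒x≡y (norm≡0⇒x≡0 (begin
      norm (a - b , s)                        ≡⟨ cong ((a - b) * (a - b) +_) A≡s² ⟨
      (a - b) * (a - b) + archimedes a b 0#   ≡⟨ solve 2 (λ a b → (a :- b) :* (a :- b) :+ :archimedes a b :0 := :0) refl a b ⟩
      0#                                      ∎))

    -- (2c)² (α² + β²) = (a + c - b)² + archimedes a b c = 4ac
    apex-norm : ∀ {a b c s α β} → c ≢ 0# → archimedes a b c ≡ s * s →
                two * c * α ≡ a + c - b → two * c * β ≡ s → norm (α , β) * c ≡ a
    apex-norm {a} {b} {c} {s} {α} {β} c≢0 A≡s² 2cα≡a+c-b 2cβ≡s = *-cancelˡ (*-≢0 2c≢0 2c≢0) (begin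
      two * c * (two * c) * (norm (α , β) * c)              ≡⟨ solve 3 (λ c α β →
        :2 :* c :* (:2 :* c) :* (:norm α β :* c) := :norm (:2 :* c :* α) (:2 :* c :* β) :* c) refl c α β ⟩
      norm (two * c * α , two * c * β) * c                  ≡⟨ cong₂ (λ u v → norm (u , v) * c) 2cα≡a+c-b 2cβ≡s ⟩
      norm (a + c - b , s) * c                              ≡⟨ cong (λ z → ((a + c - b) * (a + c - b) + z) * c) A≡s² ⟨
      ((a + c - b) * (a + c - b) + archimedes a b c) * c    ≡⟨ solve 3 (λ a b c →
        ((a :+ c :- b) :* (a :+ c :- b) :+ :archimedes a b c) :* c := :2 :* c :* (:2 :* c) :* a) refl a b c ⟩
      two * c * (two * c) * a                               ∎)
      where
      2c≢0 = *-≢0 two≢0 c≢0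

    nondegenerate-triangle : ∀ {a b s} w → norm w ≢ 0# → archimedes a b (norm w) ≡ s * s →
                             ∃ λ u → norm u ≡ a × norm (w -ᵥ u) ≡ b
    nondegenerate-triangle {a} {b} {s} w c≢0 A≡s² = ζ *ᵥ w , (begin
      norm (ζ *ᵥ w)              ≡⟨ norm-*ᵥ ζ w ⟩
      norm ζ * c                 ≡⟨ apex-norm c≢0 A≡s² (2c* (a + c - b)) (2c* s) ⟩
      a                          ∎) , (begin
      norm (w -ᵥ ζ *ᵥ w)         ≡⟨ cong norm (w-ζw≡[1-ζ]w ζ w) ⟩
      norm ((1ᵥ -ᵥ ζ) *ᵥ w)      ≡⟨ norm-*ᵥ (1ᵥ -ᵥ ζ) w ⟩
      norm (1ᵥ -ᵥ ζ) * c         ≡⟨ apex-norm c≢0 A′≡s′² 2c[1-α]≡b+c-a 2c[0-β]≡-s ⟩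
      b                          ∎)
      where
      c = norm w
      h = proj₁ (inverse (two * c) (*-≢0 two≢0 c≢0))

      2c* : ∀ x → two * c * (h * x) ≡ x
      2c* x = begin
        two * c * (h * x)      ≡⟨ solve 3 (λ c h x → :2 :* c :* (h :* x) := (:2 :* c :* h) :* x) refl c h x ⟩
        (two * c * h) * x      ≡⟨ cong (_* x) (proj₂ (inverse (two * c) (*-≢0 two≢0 c≢0))) ⟩
        1# * x                 ≡⟨ *-identityˡ x ⟩
        x                      ∎

      ζ : Point
      ζ = h * (a + c - b) , h * s

      A′≡s′² : archimedes b a c ≡ (- s) * (- s)
      A′≡s′² = begin
        archimedes b a c   ≡⟨ solve 3 (λ a b c → :archimedes b a c := :archimedes a b c) refl a b c ⟩
        archimedes a b c   ≡⟨ A≡s² ⟩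
        s * s              ≡⟨ solve 1 (λ s → s :* s := (:- s) :* (:- s)) refl s ⟩
        (- s) * (- s)      ∎

      2c[1-α]≡b+c-a : two * c * (1# - h * (a + c - b)) ≡ b + c - a
      2c[1-α]≡b+c-a = begin
        two * c * (1# - h * (a + c - b))          ≡⟨ solve 2 (λ c z → :2 :* c :* (:1 :- z) := :2 :* c :- :2 :* c :* z) refl c _ ⟩
        two * c - two * c * (h * (a + c - b))     ≡⟨ cong (λ z → two * c - z) (2c* (a + c - b)) ⟩
        two * c - (a + c - b)                     ≡⟨ solve 3 (λ a b c → :2 :* c :- (a :+ c :- b) := b :+ c :- a) refl a b c ⟩
        b + c - a                                 ∎

      2c[0-β]≡-s : two * c * (0# - h * s) ≡ - s
      2c[0-β]≡-s = begin
        two * c * (0# - h * s)    ≡⟨ solve 2 (λ c z → :2 :* c :* (:0 :- z) := :- (:2 :* c :* z)) refl c _ ⟩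
        - (two * c * (h * s))     ≡⟨ cong -_ (2c* s) ⟩
        - s                       ∎

    triangle : ∀ {a b s} w → archimedes a b (norm w) ≡ s * s → ∃ λ u → norm u ≡ a × norm (w -ᵥ u) ≡ b
    triangle {a} {b} {s} w A≡s² = by-cases (norm w ≟ 0#)
      where
      by-cases : Dec (norm w ≡ 0#) → ∃ λ u → norm u ≡ a × norm (w -ᵥ u) ≡ b
      by-cases (no  c≢0) = nondegenerate-triangle w c≢0 A≡s²
      by-cases (yes c≡0) = let u , u²≡a = norm-surjective a in u , u²≡a , (begin
        norm (w -ᵥ u)    ≡⟨ cong (λ P → norm (P -ᵥ u)) (norm≡0⇒≡0ᵥ c≡0) ⟩
        norm (0ᵥ -ᵥ u)   ≡⟨ trans (cong norm (cong₂ _,_ (+-identityˡ _) (+-identityˡ _))) (norm-ᵥ u) ⟩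
        norm u           ≡⟨ u²≡a ⟩
        a                ≡⟨ archimedes-at-0 (trans (cong (archimedes a b) (sym c≡0)) A≡s²) ⟩
        b                ∎)

    diagonal : ∀ {a b} → a ≢ 0# → b ≢ 0# → ∃ λ c → c ≢ 0# × ∃ λ s → archimedes a b c ≡ s * s
    diagonal {a} {b} a≢0 b≢0 = let (t , s) , t²+s²≡4ab = norm-surjective (two * two * (a * b))
                               in choose t s t²+s²≡4ab (a + b + t ≟ 0#) (a + b - t ≟ 0#)
      where
      choose : ∀ t s → norm (t , s) ≡ two * two * (a * b) → Dec (a + b + t ≡ 0#) → Dec (a + b - t ≡ 0#) →
               ∃ λ c → c ≢ 0# × ∃ λ s → archimedes a b c ≡ s * s
      choose t s t²+s²≡4ab (no c₊≢0) _ = a + b + t , c₊≢0 , s , archimedes-shift t²+s²≡4ab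
      choose t s t²+s²≡4ab (yes _) (no c₋≢0) =
        a + b - t , c₋≢0 , s , archimedes-shift
          (trans (solve 2 (λ t s → :norm (:- t) s := :norm t s) refl t s) t²+s²≡4ab)
      choose t s t²+s²≡4ab (yes c₊≡0) (yes c₋≡0) = contradiction (two*x≡0⇒x≡0 (two*x≡0⇒x≡0 (begin
        two * (two * a)                            ≡⟨ solve 3 (λ a b t →
          :2 :* (:2 :* a) := (a :+ b :+ t) :+ (a :+ b :- t) :+ :2 :* (a :- b)) refl a b t ⟩
        (a + b + t) + (a + b - t) + two * (a - b)  ≡⟨ cong₂ (λ x y → x + y + two * (a - b)) c₊≡0 c₋≡0 ⟩
        0# + 0# + two * (a - b)                    ≡⟨ cong (λ z → 0# + 0# + two * z) a-b≡0 ⟩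
        0# + 0# + two * 0#                         ≡⟨ solve 0 (:0 :+ :0 :+ :2 :* :0 := :0) refl ⟩
        0#                                         ∎))) a≢0
        where
        a-b≡0 : a - b ≡ 0#
        a-b≡0 = norm≡0⇒x≡0 (begin
          norm (a - b , s)                                              ≡⟨ solve 4 (λ a b t s →
            :norm (a :- b) s := (a :+ b :+ t) :* (a :+ b :- t) :+ (:norm t s :- :2 :* :2 :* (a :* b))) refl a b t s ⟩
          (a + b + t) * (a + b - t) + (norm (t , s) - two * two * (a * b)) ≡⟨ cong₂ (λ x y → x * (a + b - t) + y)
                                                                              c₊≡0 (x≈y⇒x∙y⁻¹≈ε t²+s²≡4ab) ⟩
          0# * (a + b - t) + 0#                                         ≡⟨ solve 1 (λ z → :0 :* z :+ :0 := :0) refl _ ⟩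
          0#                                                            ∎)

    norm-direction-≢0 : ∀ p → norm (direction p) ≢ 0#
    norm-direction-≢0 nothing  = 1#≢0# ∘ cong proj₂ ∘ norm≡0⇒≡0ᵥ
    norm-direction-≢0 (just m) = 1#≢0# ∘ cong proj₁ ∘ norm≡0⇒≡0ᵥ

    coefficient : Point → ℙ¹ → Carrier
    coefficient B p = - (two * dot B (direction p)) * proj₁ (inverse (norm (direction p)) (norm-direction-≢0 p))

    -- B reflected in the line through 0ᵥ perpendicular to direction p; as p runs over ℙ¹ this
    -- parametrises the circle through B.
    reflect : Point → ℙ¹ → Point
    reflect B p = B +ᵥ coefficient B p ·ᵥ direction p

    coefficient-spec : ∀ B p → coefficient B p * norm (direction p) ≡ - (two * dot B (direction p))
    coefficient-spec B p = begin
      X * d⁻¹ * d     ≡⟨ solve 3 (λ X d⁻¹ d → X :* d⁻¹ :* d := X :* (d :* d⁻¹)) refl X d⁻¹ d ⟩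
      X * (d * d⁻¹)   ≡⟨ cong (X *_) (proj₂ (inverse d (norm-direction-≢0 p))) ⟩
      X * 1#          ≡⟨ *-identityʳ X ⟩
      X               ∎
      where
      X = - (two * dot B (direction p))
      d = norm (direction p)
      d⁻¹ = proj₁ (inverse d (norm-direction-≢0 p))

    norm-reflect : ∀ B p → norm (reflect B p) ≡ norm B
    norm-reflect B p = begin
      norm (B +ᵥ t ·ᵥ d)                          ≡⟨ expand B d ⟩
      norm B + t * (two * dot B d + t * norm d)   ≡⟨ cong (λ z → norm B + t * (two * dot B d + z)) (coefficient-spec B p) ⟩
      norm B + t * (two * dot B d - two * dot B d) ≡⟨ solve 3 (λ n t X → n :+ t :* (X :- X) := n)
                                                          refl (norm B) t (two * dot B d) ⟩
      norm B                                      ∎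
      where
      t = coefficient B p
      d = direction p
      expand : ∀ B d → norm (B +ᵥ t ·ᵥ d) ≡ norm B + t * (two * dot B d + t * norm d)
      expand (α , β) (x , y) = solve 5 (λ α β t x y →
        :norm (α :+ t :* x) (β :+ t :* y) := :norm α β :+ t :* (:2 :* (α :* x :+ β :* y) :+ t :* :norm x y)) refl α β t x y

    reflect-injective : ∀ {B} → norm B ≢ 0# → Injective _≡_ _≡_ (reflect B)
    reflect-injective {B} B≢0 {p} {p′} e with scaled-directions p p′ (+ᵥ-cancelˡ e)
    ... | inj₁ p≡p′           = p≡p′
    ... | inj₂ (t≡0 , t′≡0)   =
      perpendicular-direction-unique B≢0ᵥ p p′ (perpendicular p t≡0) (perpendicular p′ t′≡0)
      where
      B≢0ᵥ : B ≢ 0ᵥ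
      B≢0ᵥ B≡0 = B≢0 (trans (cong norm B≡0) (solve 0 (:norm :0 :0 := :0) refl))

      perpendicular : ∀ p → coefficient B p ≡ 0# → dot B (direction p) ≡ 0#
      perpendicular p t≡0 = two*x≡0⇒x≡0 (begin
        two * dot B (direction p)                       ≡⟨ ⁻¹-involutive _ ⟨
        - - (two * dot B (direction p))                 ≡⟨ cong -_ (coefficient-spec B p) ⟨
        - (coefficient B p * norm (direction p))        ≡⟨ cong (λ t → - (t * norm (direction p))) t≡0 ⟩
        - (0# * norm (direction p))                     ≡⟨ solve 1 (λ d → :- (:0 :* d) := :0) refl _ ⟩
        0#                                              ∎)

    circles-abscissae-meet : ∀ {r₁ r₂} k₁ k₂ → r₁ ≢ 0# → r₂ ≢ 0# →
                             ∃₂ λ P₁ P₂ → norm P₁ ≡ r₁ × norm P₂ ≡ r₂ × k₁ + proj₁ P₁ ≡ k₂ + proj₁ P₂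
    circles-abscissae-meet {r₁} {r₂} k₁ k₂ r₁≢0 r₂≢0 =
      let B₁ , B₁²≡r₁ = norm-surjective r₁
          B₂ , B₂²≡r₂ = norm-surjective r₂
          u , v , e = ℙ¹-images-meet (chart k₁ B₁) (chart k₂ B₂)
                        (chart-injective k₁ (r₁≢0 ∘ trans (sym B₁²≡r₁)))
                        (chart-injective k₂ (r₂≢0 ∘ trans (sym B₂²≡r₂)))
      in reflect B₁ u , reflect B₂ v ,
         trans (norm-reflect B₁ u) B₁²≡r₁ , trans (norm-reflect B₂ v) B₂²≡r₂ , cong proj₂ e
      where
      chart : Carrier → Point → ℙ¹ → Bool × Carrier
      chart k B p = sign (proj₂ (reflect B p)) , k + proj₁ (reflect B p)

      chart-injective : ∀ k {B} → norm B ≢ 0# → Injective _≡_ _≡_ (chart k B)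
      chart-injective k {B} B≢0 {p} {p′} e = reflect-injective B≢0 (on-circle-injective
        (trans (norm-reflect B p) (sym (norm-reflect B p′))) (∙-cancelˡ k _ _ (cong proj₂ e)) (cong proj₁ e))

    -- archimedes a b c = 4ab - (c - a - b)², so a diagonal serving both triangles is a common
    -- abscissa of two shifted circles.
    common-diagonal : ∀ {a₀ a₁ a₂ a₃} → a₀ * a₁ ≢ 0# → a₂ * a₃ ≢ 0# →
                      ∃ λ c → ∃₂ λ s₁ s₂ → archimedes a₀ a₁ c ≡ s₁ * s₁ × archimedes a₂ a₃ c ≡ s₂ * s₂
    common-diagonal {a₀} {a₁} {a₂} {a₃} a₀a₁≢0 a₂a₃≢0 =
      let (t₁ , s₁) , (t₂ , s₂) , T₁ , T₂ , c₁≡c₂ =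
            circles-abscissae-meet (a₀ + a₁) (a₂ + a₃) (*-≢0 4≢0 a₀a₁≢0) (*-≢0 4≢0 a₂a₃≢0)
      in a₀ + a₁ + t₁ , s₁ , s₂ , archimedes-shift T₁ ,
         subst (λ c → archimedes a₂ a₃ c ≡ s₂ * s₂) (sym c₁≡c₂) (archimedes-shift T₂)
      where
      4≢0 = *-≢0 two≢0 two≢0

    two-triangles : ∀ {s₁ s₂} (a : Fin 4 → Carrier) w →
                    archimedes (a 0F) (a 1F) (norm w) ≡ s₁ * s₁ → archimedes (a 2F) (a 3F) (norm w) ≡ s₂ * s₂ →
                    Polygon a
    two-triangles a w A₁ A₂
      with u₁ , u₁²≡a₀ , [w-u₁]²≡a₁ ← triangle w A₁
         | u₂ , u₂²≡a₂ , [-w-u₂]²≡a₃ ← triangle (-ᵥ w) (trans (cong (archimedes (a 2F) (a 3F)) (norm-ᵥ w)) A₂)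
      = (u₁ ∷ w -ᵥ u₁ ∷ u₂ ∷ -ᵥ w -ᵥ u₂ ∷ []) , v≡a , closed u₁ w u₂
      where
      v≡a : ∀ i → norm ((u₁ ∷ w -ᵥ u₁ ∷ u₂ ∷ -ᵥ w -ᵥ u₂ ∷ []) i) ≡ a i
      v≡a 0F = u₁²≡a₀
      v≡a 1F = [w-u₁]²≡a₁
      v≡a 2F = u₂²≡a₂
      v≡a 3F = [-w-u₂]²≡a₃

      closed : ∀ u₁ w u₂ → ∑ᵥ (u₁ ∷ w -ᵥ u₁ ∷ u₂ ∷ -ᵥ w -ᵥ u₂ ∷ []) ≡ 0ᵥ
      closed (x₁ , y₁) (x , y) (x₂ , y₂) = cong₂ _,_
        (solve 3 (λ x₁ x x₂ → x₁ :+ ((x :- x₁) :+ (x₂ :+ ((:- x :- x₂) :+ :0))) := :0) refl x₁ x x₂)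
        (solve 3 (λ y₁ y y₂ → y₁ :+ ((y :- y₁) :+ (y₂ :+ ((:- y :- y₂) :+ :0))) := :0) refl y₁ y y₂)

    quadrilateral : (a : Fin 4 → Carrier) → (∀ i → a i ≢ 0#) → Polygon a
    quadrilateral a a≢0 =
      let c , s₁ , s₂ , A₁ , A₂ = common-diagonal (*-≢0 (a≢0 0F) (a≢0 1F)) (*-≢0 (a≢0 2F) (a≢0 3F))
          w , w²≡c = norm-surjective c
      in two-triangles a w (subst (λ c → archimedes (a 0F) (a 1F) c ≡ s₁ * s₁) (sym w²≡c) A₁)
                           (subst (λ c → archimedes (a 2F) (a 3F) c ≡ s₂ * s₂) (sym w²≡c) A₂)

    split-first-edge : ∀ {n c s} (a : Fin (2 ℕ.+ n) → Carrier) → archimedes (a 0F) (a 1F) c ≡ s * s →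
                       Polygon (c ∷ a ∘ Fin.suc ∘ Fin.suc) → Polygon a
    split-first-edge a A≡s² (v , v≡a′ , closed)
      with u , u²≡a₀ , [v₀-u]²≡a₁ ← triangle (Vec.head v) (trans (cong (archimedes (a 0F) (a 1F)) (v≡a′ 0F)) A≡s²)
      = (u ∷ Vec.head v -ᵥ u ∷ Vec.tail v) , v≡a , trans (telescope u (Vec.head v) (∑ᵥ (Vec.tail v))) closed
      where
      v≡a : ∀ i → norm ((u ∷ Vec.head v -ᵥ u ∷ Vec.tail v) i) ≡ a i
      v≡a 0F                      = u²≡a₀
      v≡a 1F                      = [v₀-u]²≡a₁
      v≡a (Fin.suc (Fin.suc i))   = v≡a′ (Fin.suc i)

      telescope : ∀ u w R → u +ᵥ (w -ᵥ u +ᵥ R) ≡ w +ᵥ R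
      telescope (x₁ , y₁) (x , y) (x₂ , y₂) = cong₂ _,_
        (solve 3 (λ x₁ x x₂ → x₁ :+ (x :- x₁ :+ x₂) := x :+ x₂) refl x₁ x x₂)
        (solve 3 (λ y₁ y y₂ → y₁ :+ (y :- y₁ :+ y₂) := y :+ y₂) refl y₁ y y₂)

    polygon : ∀ m (a : Fin (4 ℕ.+ m) → Carrier) → (∀ i → a i ≢ 0#) → Polygon a
    polygon zero    = quadrilateral
    polygon (suc m) a a≢0 =
      let c , c≢0 , s , A≡s² = diagonal (a≢0 0F) (a≢0 1F)
      in split-first-edge a A≡s² (polygon m (c ∷ a ∘ Fin.suc ∘ Fin.suc) λ where
           0F          → c≢0
           (Fin.suc i) → a≢0 (Fin.suc (Fin.suc i)))

theorem1 : (q : ℕ) (F : FiniteField q) → q % 4 ≡ 3 →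
    (n : ℕ) → 4 ≤ n →
    (a : Fin n → FiniteField.Carrier F) → (∀ i → a i ≢ FiniteField.0# F) →
    ∃ λ (A : Fin n → FiniteField.Point F) →
      ∀ i → FiniteField.Q F (A i) (A (next i)) ≡ a i
theorem1 q F q%4≡3 .(4 ℕ.+ m) (s≤s (s≤s (s≤s (s≤s (z≤n {m}))))) a a≢0 = vertices (polygon m a a≢0)
  where
  open Field F
  open Anisotropic (q%4≡3⇒-1-nonsquare q%4≡3)
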